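{- Let $R$ and $S$ be finite rings with identity. Then $Cl(R) \cong Cl(S)$ if and only if $Cl_2(R) \cong Cl_2(S)$.
   Context: For a ring $R$ with identity, $Id(R)$ denotes the set of idempotents and $U(R)$ the set of units of $R$. The clean graph $Cl(R)$ has vertex set $Id(R) \times U(R)$, and two distinct vertices $(e,u)$ and $(f,v)$ are adjacent if and only if $ef=fe=0$ or $uv=vu=1$. $Cl_2(R)$ is the induced subgraph of $Cl(R)$ on the vertex set $\{(e,u): e \in Id(R)\setminus\{0\},\ u \in U(R)\}$. $\cong$ denotes graph isomorphism. -}

module Defs where

open import Level using (Level; _⊔_; suc)
open import Algebra.Bundles using (Ring)
open import Data.Fin using (Fin)
open import Data.Nat using (ℕ)
open import Data.Product using (Σ; ∃; _×_; _,_; proj₁; proj₂)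
open import Data.Sum using (_⊎_)
open import Relation.Nullary using (¬_)
open import Relation.Binary using (Setoid)
open import Relation.Binary.PropositionalEquality as ≡ using (_≡_)
open import Function.Bundles using (Inverse)

IsFinite : ∀ {a ℓ} → Setoid a ℓ → Set (a ⊔ ℓ)
IsFinite S = ∃ λ (n : ℕ) → Inverse S (≡.setoid (Fin n))

FiniteRing : ∀ {c ℓ} → Ring c ℓ → Set (c ⊔ ℓ)
FiniteRing R = IsFinite (Ring.setoid R)

record Graph (a ℓ r : Level) : Set (suc (a ⊔ ℓ ⊔ r)) where
  field
    V   : Setoid a ℓ
    Adj : Setoid.Carrier V → Setoid.Carrier V → Set r

record _≅_ {a ℓ r a' ℓ' r'} (G : Graph a ℓ r) (H : Graph a' ℓ' r')
       : Set (a ⊔ ℓ ⊔ r ⊔ a' ⊔ ℓ' ⊔ r') where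
  field
    bij : Inverse (Graph.V G) (Graph.V H)
  open Inverse bij using (to)
  field
    adj-to   : ∀ x y → Graph.Adj G x y → Graph.Adj H (to x) (to y)
    adj-from : ∀ x y → Graph.Adj H (to x) (to y) → Graph.Adj G x y

module _ {c ℓ} (R : Ring c ℓ) where
  open Ring R

  Idempotent : Carrier → Set ℓ
  Idempotent e = e * e ≈ e

  IsUnit : Carrier → Set (c ⊔ ℓ)
  IsUnit u = ∃ λ v → (u * v ≈ 1#) × (v * u ≈ 1#)

  vertexSetoid : ∀ {p} → (Carrier → Set p) → Setoid (c ⊔ ℓ ⊔ p) ℓ
  vertexSetoid P = record
    { Carrier = Σ (Carrier × Carrier) (λ { (e , u) → (Idempotent e × P e) × IsUnit u })
    ; _≈_ = λ x y → (proj₁ (proj₁ x) ≈ proj₁ (proj₁ y)) × (proj₂ (proj₁ x) ≈ proj₂ (proj₁ y))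
    ; isEquivalence = record
      { refl = refl , refl
      ; sym = λ { (p , q) → sym p , sym q }
      ; trans = λ { (p , q) (p' , q') → trans p p' , trans q q' } }
    }

  cleanAdj : Carrier × Carrier → Carrier × Carrier → Set ℓ
  cleanAdj (e , u) (f , v) =
    ¬ ((e ≈ f) × (u ≈ v)) ×
    (((e * f ≈ 0#) × (f * e ≈ 0#)) ⊎ ((u * v ≈ 1#) × (v * u ≈ 1#)))

  cleanGraphOn : ∀ {p} → (Carrier → Set p) → Graph (c ⊔ ℓ ⊔ p) ℓ ℓ
  cleanGraphOn P = record
    { V = vertexSetoid P
    ; Adj = λ x y → cleanAdj (proj₁ x) (proj₁ y) }

  record Trivial : Set where

  Cl : Graph (c ⊔ ℓ) ℓ ℓ
  Cl = cleanGraphOn (λ _ → Trivial)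

  Cl₂ : Graph (c ⊔ ℓ) ℓ ℓ
  Cl₂ = cleanGraphOn (λ e → ¬ (e ≈ 0#))

{-# OPTIONS --safe #-}
-- Every vertex (0 , u) of Cl(R) is adjacent to all other vertices, so Cl(R) is the join of the
-- complete graph on U(R) with Cl₂(R), and |Cl(R)| = |U(R)| + |Id(R) ∖ {0}| · |U(R)|.
--
-- (⇐) An isomorphism Cl₂(R) ≅ Cl₂(S) forces |U(R)| = |U(S)|: counting vertices gives
-- |Id(R) ∖ {0}| · |U(R)| = |Id(S) ∖ {0}| · |U(S)|, and comparing the neighbourhood of (1 , 1) with
-- that of its image gives |Id(R) ∖ {0}| = |Id(S) ∖ {0}|. The two joins are then isomorphic.
--
-- (⇒) If both rings have a unit other than 1, the vertices of Cl with nonzero idempotent are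
-- exactly the non-dominating ones, so an isomorphism Cl(R) ≅ Cl(S) restricts to Cl₂. Otherwise
-- one, hence each, of Cl(R) and Cl(S) is complete; then 1 is the only unit of either ring and
-- Cl₂(R), Cl₂(S) are complete graphs with the same number of vertices.
module Submission where

open import Defs

open import Level using (Level; _⊔_; 0ℓ)
open import Algebra.Bundles using (Ring)
open import Data.Nat as ℕ using (ℕ; zero; suc; _≤_)
import Data.Nat.Properties as ℕ
open import Data.Fin as Fin using (Fin; zero; suc)
import Data.Fin.Properties as Fin
open import Data.Product as Prod using (Σ; ∃; _×_; _,_; proj₁; proj₂; swap)
open import Data.Product.Relation.Binary.Pointwise.NonDependent as Pointwise× using (_×ₛ_)
open import Data.Product.Function.NonDependent.Setoid using (_×-inverse_)
open import Data.Sum.Relation.Binary.Pointwise as Pointwise⊎ using (_⊎ₛ_)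
open import Data.Sum.Function.Setoid using (_⊎-inverse_)
open import Data.Empty using (⊥-elim)
open import Data.Sum as Sum using (_⊎_; inj₁; inj₂)
open import Data.Unit.Polymorphic using (⊤; tt)
open import Function.Base using (_∘_; id)
open import Function.Bundles using (Inverse; Injection; Equivalence; _⇔_; mk⇔)
open import Function.Properties.Inverse using (Inverse⇒Injection)
import Function.Construct.Composition as Compose
import Function.Construct.Identity as Identity
import Function.Construct.Symmetry as Symmetry
open import Relation.Nullary using (¬_; Dec; yes; no)
open import Relation.Nullary.Decidable using (_×-dec_; ¬?)
open import Relation.Unary using (Pred; Decidable)
open import Relation.Binary using (Setoid; _Respects_; _Respects₂_; _Respectsʳ_; Irreflexive; Symmetric)
import Relation.Binary.Construct.On as On
open import Relation.Binary.PropositionalEquality as ≡ using (_≡_; cong)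

private
  variable
    a b ℓ ℓ' p : Level

  to-injective : ∀ {A : Setoid a ℓ} {B : Setoid b ℓ'} (f : Inverse A B) → ∀ {x y} →
                 Setoid._≈_ B (Inverse.to f x) (Inverse.to f y) → Setoid._≈_ A x y
  to-injective f = Injection.injective (Inverse⇒Injection f)

-- Finite setoids

Card : Setoid a ℓ → ℕ → Set (a ⊔ ℓ)
Card A n = Inverse A (≡.setoid (Fin n))

Subsetoid : (A : Setoid a ℓ) → Pred (Setoid.Carrier A) p → Setoid (a ⊔ p) ℓ
Subsetoid A P = On.setoid A (proj₁ {B = P})

module _ {A : Setoid a ℓ} {B : Setoid b ℓ'} where

  Card-≤ : ∀ {m n} → Card A m → Card B n → Injection A B → m ≤ n
  Card-≤ {m} {n} cardA cardB f = Fin.injective⇒≤ (Injection.injective fin)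
    where
      fin : Injection (≡.setoid (Fin m)) (≡.setoid (Fin n))
      fin = Compose.injection (Inverse⇒Injection (Symmetry.inverse cardA))
              (Compose.injection f (Inverse⇒Injection cardB))

  Card⇒Inverse : ∀ {n} → Card A n → Card B n → Inverse A B
  Card⇒Inverse cardA cardB = Compose.inverse cardA (Symmetry.inverse cardB)

  Card-⊎ : ∀ {m n} → Card A m → Card B n → Card (A ⊎ₛ B) (m ℕ.+ n)
  Card-⊎ {m} cardA cardB =
    Compose.inverse (cardA ⊎-inverse cardB)
      (Compose.inverse (Pointwise⊎.Pointwise-≡↔≡ _ _) (Symmetry.inverse (Fin.+↔⊎ {m})))

  Card-× : ∀ {m n} → Card A m → Card B n → Card (A ×ₛ B) (m ℕ.* n)
  Card-× {m} cardA cardB =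
    Compose.inverse (cardA ×-inverse cardB)
      (Compose.inverse Pointwise×.Pointwise-≡↔≡ (Symmetry.inverse (Fin.*↔× {m})))

module _ {A : Setoid a ℓ} where
  open Setoid A

  Card-unique : ∀ {m n} → Card A m → Card A n → m ≡ n
  Card-unique cardA cardA' =
    ℕ.≤-antisym (Card-≤ cardA cardA' (Identity.injection A)) (Card-≤ cardA' cardA (Identity.injection A))

  Card-nonZero : ∀ {n} → Card A n → Carrier → ℕ.NonZero n
  Card-nonZero {suc n} _ _ = _
  Card-nonZero {zero} cardA x with Inverse.to cardA x
  ... | ()

  Card⇒≈-dec : ∀ {n} → Card A n → ∀ x y → Dec (x ≈ y)
  Card⇒≈-dec cardA x y with Inverse.to cardA x Fin.≟ Inverse.to cardA y
  ... | yes eq = yes (to-injective cardA eq)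
  ... | no neq = no (λ x≈y → neq (Inverse.to-cong cardA x≈y))

  Card⇒∃-dec : ∀ {n} {P : Pred Carrier p} → Card A n → Decidable P → P Respects _≈_ → Dec (∃ P)
  Card⇒∃-dec cardA P? resp with Fin.any? (λ i → P? (Inverse.from cardA i))
  ... | yes (_ , Px) = yes (_ , Px)
  ... | no ¬∃ = no λ { (x , Px) → ¬∃ (Inverse.to cardA x , resp (sym (Inverse.strictlyInverseʳ cardA x)) Px) }

module _ {n} {P : Pred (Fin (suc n)) p} where
  private
    Σₛ : ∀ {m} → Pred (Fin m) p → Setoid p 0ℓ
    Σₛ Q = Subsetoid (≡.setoid (Fin _)) Q

  Card-Σ-Fin-here : P zero → ∀ {k} → Card (Σₛ (P ∘ suc)) k → Card (Σₛ P) (suc k)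
  Card-Σ-Fin-here P0 {k} card = record
    { to = to ; from = from ; to-cong = to-cong ; from-cong = λ { ≡.refl → ≡.refl }
    ; inverse = inverseˡ , inverseʳ }
    where
      module C = Inverse card
      to : Σ (Fin (suc n)) P → Fin (suc k)
      to (zero , _) = zero
      to (suc i , Pi) = suc (C.to (i , Pi))
      from : Fin (suc k) → Σ (Fin (suc n)) P
      from zero = zero , P0
      from (suc j) = Prod.map suc id (C.from j)
      to-cong : ∀ {x y} → proj₁ x ≡ proj₁ y → to x ≡ to y
      to-cong {zero , _} {zero , _} _ = ≡.refl
      to-cong {suc _ , _} {suc _ , _} ≡.refl = cong suc (C.to-cong ≡.refl)
      inverseˡ : ∀ {x j} → proj₁ x ≡ proj₁ (from j) → to x ≡ j
      inverseˡ {zero , _} {zero} _ = ≡.refl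
      inverseˡ {suc _ , _} {suc _} eq = cong suc (C.inverseˡ (Fin.suc-injective eq))
      inverseʳ : ∀ {j x} → j ≡ to x → proj₁ (from j) ≡ proj₁ x
      inverseʳ {_} {zero , _} ≡.refl = ≡.refl
      inverseʳ {_} {suc _ , _} ≡.refl = cong suc (C.inverseʳ ≡.refl)

  Card-Σ-Fin-there : ¬ P zero → ∀ {k} → Card (Σₛ (P ∘ suc)) k → Card (Σₛ P) k
  Card-Σ-Fin-there ¬P0 card = Compose.inverse shift card
    where
      shift : Inverse (Σₛ P) (Σₛ (P ∘ suc))
      shift = record
        { to = λ { (zero , P0) → ⊥-elim (¬P0 P0) ; (suc i , Pi) → i , Pi }
        ; from = Prod.map suc id
        ; to-cong = λ { {zero , P0} _ → ⊥-elim (¬P0 P0) ; {suc _ , _} {zero , P0} _ → ⊥-elim (¬P0 P0)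
                      ; {suc _ , _} {suc _ , _} ≡.refl → ≡.refl }
        ; from-cong = cong suc
        ; inverse = (λ { {_} {zero , P0} _ → ⊥-elim (¬P0 P0) ; {_} {suc _ , _} ≡.refl → ≡.refl })
                  , (λ { {zero , P0} _ → ⊥-elim (¬P0 P0) ; {suc _ , _} ≡.refl → ≡.refl }) }

Card-Σ-Fin : ∀ n {P : Pred (Fin n) p} → Decidable P → ∃ (Card (Subsetoid (≡.setoid (Fin n)) P))
Card-Σ-Fin zero P? = 0 , record
  { to = λ { (() , _) } ; from = λ () ; to-cong = λ { {() , _} } ; from-cong = λ { {()} }
  ; inverse = (λ { {()} }) , (λ { {() , _} }) }
Card-Σ-Fin (suc n) P? with Card-Σ-Fin n (P? ∘ suc) | P? zero
... | k , card | yes P0 = suc k , Card-Σ-Fin-here P0 card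
... | k , card | no ¬P0 = k , Card-Σ-Fin-there ¬P0 card

Card-Subsetoid : ∀ {A : Setoid a ℓ} {n} {P : Pred (Setoid.Carrier A) p} → Card A n →
                 Decidable P → P Respects (Setoid._≈_ A) → ∃ (Card (Subsetoid A P))
Card-Subsetoid {A = A} {n} {P} cardA P? resp = Prod.map₂ (Compose.inverse reindex) (Card-Σ-Fin n (P? ∘ C.from))
  where
    module C = Inverse cardA
    reindex : Inverse (Subsetoid A P) (Subsetoid (≡.setoid (Fin n)) (P ∘ C.from))
    reindex = record
      { to = λ { (x , Px) → C.to x , resp (Setoid.sym A (C.strictlyInverseʳ x)) Px }
      ; from = Prod.map C.from id
      ; to-cong = C.to-cong ; from-cong = C.from-cong
      ; inverse = C.inverseˡ , C.inverseʳ }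

-- Graphs

module _ {a ℓ r} (G : Graph a ℓ r) where
  open Graph G
  open Setoid V

  Dominating : Carrier → Set (a ⊔ ℓ ⊔ r)
  Dominating x = ∀ y → ¬ x ≈ y → Adj x y

  Complete : Set (a ⊔ ℓ ⊔ r)
  Complete = ∀ x → Dominating x

module _ {a ℓ r a' ℓ' r'} {G : Graph a ℓ r} {H : Graph a' ℓ' r'} where
  private
    module G = Graph G
    module H = Graph H
    module VG = Setoid G.V
    module VH = Setoid H.V
  open _≅_

  ≅-sym : H.Adj Respects₂ VH._≈_ → G ≅ H → H ≅ G
  ≅-sym (respʳ , respˡ) Φ = record
    { bij = Symmetry.inverse (bij Φ)
    ; adj-to = λ x y xy → adj-from Φ (Φ.from x) (Φ.from y)
        (respˡ (VH.sym (Φ.strictlyInverseˡ x)) (respʳ (VH.sym (Φ.strictlyInverseˡ y)) xy))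
    ; adj-from = λ x y xy → respˡ (Φ.strictlyInverseˡ x) (respʳ (Φ.strictlyInverseˡ y) (adj-to Φ _ _ xy)) }
    where
      module Φ = Inverse (bij Φ)

  ≅-reflects-Dominating : (Φ : G ≅ H) → ∀ {x} → Dominating H (Inverse.to (bij Φ) x) → Dominating G x
  ≅-reflects-Dominating Φ {x} dom y x≉y =
    adj-from Φ x y (dom _ (λ eq → x≉y (to-injective (bij Φ) eq)))

  ≅-reflects-Complete : G ≅ H → Complete H → Complete G
  ≅-reflects-Complete Φ complete x = ≅-reflects-Dominating Φ (complete _)

  complete-≅ : Irreflexive VG._≈_ G.Adj → Irreflexive VH._≈_ H.Adj →
               Complete G → Complete H → Inverse G.V H.V → G ≅ H
  complete-≅ irreflG irreflH completeG completeH β = record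
    { bij = β
    ; adj-to = λ x y xy → completeH _ _ (λ eq → irreflG (to-injective β eq) xy)
    ; adj-from = λ x y xy → completeG _ _ (λ eq → irreflH (Inverse.to-cong β eq) xy) }

≅-trans : ∀ {a ℓ r a' ℓ' r' a'' ℓ'' r''} {G : Graph a ℓ r} {H : Graph a' ℓ' r'} {K : Graph a'' ℓ'' r''} →
          G ≅ H → H ≅ K → G ≅ K
≅-trans Φ Ψ = record
  { bij = Compose.inverse (bij Φ) (bij Ψ)
  ; adj-to = λ x y xy → adj-to Ψ _ _ (adj-to Φ x y xy)
  ; adj-from = λ x y xy → adj-from Φ x y (adj-from Ψ _ _ xy) }
  where open _≅_

infix 30 K_∨_
K_∨_ : ∀ {a ℓ} → Setoid a ℓ → Graph a ℓ ℓ → Graph a (a ⊔ ℓ) ℓ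
K A ∨ G = record { V = A ⊎ₛ Graph.V G ; Adj = JoinAdj }
  where
    JoinAdj : Setoid.Carrier A ⊎ Setoid.Carrier (Graph.V G) → Setoid.Carrier A ⊎ Setoid.Carrier (Graph.V G) → Set _
    JoinAdj (inj₁ x) (inj₁ y) = ¬ Setoid._≈_ A x y
    JoinAdj (inj₂ x) (inj₂ y) = Graph.Adj G x y
    JoinAdj _ _ = ⊤

K∨-cong : ∀ {a ℓ a' ℓ'} {A : Setoid a ℓ} {B : Setoid a' ℓ'} {G : Graph a ℓ ℓ} {H : Graph a' ℓ' ℓ'} →
          Inverse A B → G ≅ H → K A ∨ G ≅ K B ∨ H
K∨-cong ψ φ = record
  { bij = ψ ⊎-inverse bij φ
  ; adj-to = λ { (inj₁ x) (inj₁ y) x≉y → λ eq → x≉y (to-injective ψ eq)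
               ; (inj₁ _) (inj₂ _) _ → tt ; (inj₂ _) (inj₁ _) _ → tt
               ; (inj₂ x) (inj₂ y) xy → adj-to φ x y xy }
  ; adj-from = λ { (inj₁ x) (inj₁ y) x≉y → λ eq → x≉y (Inverse.to-cong ψ eq)
                 ; (inj₁ _) (inj₂ _) _ → tt ; (inj₂ _) (inj₁ _) _ → tt
                 ; (inj₂ x) (inj₂ y) xy → adj-from φ x y xy } }
  where open _≅_

-- The clean graph of a finite ring

module CleanGraph {c ℓ} (R : Ring c ℓ) (finite : FiniteRing R) where
  open Ring R public
  open import Relation.Binary.Reasoning.Setoid setoid

  infix 4 _≟_
  _≟_ : ∀ x y → Dec (x ≈ y)
  _≟_ = Card⇒≈-dec (proj₂ finite)

  trivial⇒≈0 : 1# ≈ 0# → ∀ x → x ≈ 0#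
  trivial⇒≈0 1≈0 x = begin
    x       ≈⟨ *-identityʳ x ⟨
    x * 1#  ≈⟨ *-congˡ 1≈0 ⟩
    x * 0#  ≈⟨ zeroʳ x ⟩
    0#      ∎

  IsUnit-resp : IsUnit R Respects _≈_
  IsUnit-resp x≈y (v , xv≈1 , vx≈1) = v , trans (*-congʳ (sym x≈y)) xv≈1 , trans (*-congˡ (sym x≈y)) vx≈1

  Idempotent-resp : Idempotent R Respects _≈_
  Idempotent-resp x≈y xx≈x = trans (*-cong (sym x≈y) (sym x≈y)) (trans xx≈x x≈y)

  1-isUnit : IsUnit R 1#
  1-isUnit = 1# , *-identityˡ 1# , *-identityˡ 1#

  1-idempotent : Idempotent R 1#
  1-idempotent = *-identityˡ 1#

  0-idempotent : Idempotent R 0#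
  0-idempotent = zeroˡ 0#

  isUnit? : ∀ u → Dec (IsUnit R u)
  isUnit? u = Card⇒∃-dec (proj₂ finite) (λ v → (u * v ≟ 1#) ×-dec (v * u ≟ 1#))
    (λ v≈w (uv≈1 , vu≈1) → trans (*-congˡ (sym v≈w)) uv≈1 , trans (*-congʳ (sym v≈w)) vu≈1)

  HasNontrivialUnit : Set (c ⊔ ℓ)
  HasNontrivialUnit = ∃ λ u → IsUnit R u × ¬ u ≈ 1#

  AllUnitsTrivial : Set (c ⊔ ℓ)
  AllUnitsTrivial = ∀ u → IsUnit R u → u ≈ 1#

  hasNontrivialUnit? : Dec HasNontrivialUnit
  hasNontrivialUnit? = Card⇒∃-dec (proj₂ finite) (λ u → isUnit? u ×-dec ¬? (u ≟ 1#))
    (λ u≈v (isUnit , u≉1) → IsUnit-resp u≈v isUnit , λ v≈1 → u≉1 (trans u≈v v≈1))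

  ¬HasNontrivialUnit⇒AllUnitsTrivial : ¬ HasNontrivialUnit → AllUnitsTrivial
  ¬HasNontrivialUnit⇒AllUnitsTrivial ¬nontrivial u isUnit with u ≟ 1#
  ... | yes u≈1 = u≈1
  ... | no u≉1 = ⊥-elim (¬nontrivial (u , isUnit , u≉1))

  trivial⇒AllUnitsTrivial : 1# ≈ 0# → AllUnitsTrivial
  trivial⇒AllUnitsTrivial 1≈0 u _ = trans (trivial⇒≈0 1≈0 u) (sym (trivial⇒≈0 1≈0 1#))

  IsNonzeroIdempotent : Carrier → Set ℓ
  IsNonzeroIdempotent e = Idempotent R e × ¬ e ≈ 0#

  isNonzeroIdempotent? : ∀ e → Dec (IsNonzeroIdempotent e)
  isNonzeroIdempotent? e = (e * e ≟ e) ×-dec ¬? (e ≟ 0#)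

  IsNonzeroIdempotent-resp : IsNonzeroIdempotent Respects _≈_
  IsNonzeroIdempotent-resp e≈f (idem , e≉0) = Idempotent-resp e≈f idem , λ f≈0 → e≉0 (trans e≈f f≈0)

  Units : Setoid (c ⊔ ℓ) ℓ
  Units = Subsetoid setoid (IsUnit R)

  NonzeroIdempotents : Setoid (c ⊔ ℓ) ℓ
  NonzeroIdempotents = Subsetoid setoid IsNonzeroIdempotent

  private
    units-finite : ∃ (Card Units)
    units-finite = Card-Subsetoid (proj₂ finite) isUnit? IsUnit-resp

    nonzeroIdempotents-finite : ∃ (Card NonzeroIdempotents)
    nonzeroIdempotents-finite = Card-Subsetoid (proj₂ finite) isNonzeroIdempotent? IsNonzeroIdempotent-resp

  #units : ℕ
  #units = proj₁ units-finite

  Card-Units : Card Units #units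
  Card-Units = proj₂ units-finite

  #nonzeroIdempotents : ℕ
  #nonzeroIdempotents = proj₁ nonzeroIdempotents-finite

  Card-NonzeroIdempotents : Card NonzeroIdempotents #nonzeroIdempotents
  Card-NonzeroIdempotents = proj₂ nonzeroIdempotents-finite

  V : Setoid (c ⊔ ℓ) ℓ
  V = Graph.V (Cl R)

  V₂ : Setoid (c ⊔ ℓ) ℓ
  V₂ = Graph.V (Cl₂ R)

  adj-same-idempotent⇒*≈1 : ∀ {e u v} → Idempotent R e → ¬ e ≈ 0# →
                            cleanAdj R (e , u) (e , v) → u * v ≈ 1#
  adj-same-idempotent⇒*≈1 e-idem e≉0 (_ , inj₁ (ee≈0 , _)) = ⊥-elim (e≉0 (trans (sym e-idem) ee≈0))
  adj-same-idempotent⇒*≈1 e-idem e≉0 (_ , inj₂ (uv≈1 , _)) = uv≈1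

  adj-one⇒unit≈1 : ∀ {f w} → cleanAdj R (1# , 1#) (f , w) → ¬ f ≈ 0# → w ≈ 1#
  adj-one⇒unit≈1 {f} (_ , inj₁ (1f≈0 , _)) f≉0 = ⊥-elim (f≉0 (trans (sym (*-identityˡ f)) 1f≈0))
  adj-one⇒unit≈1 {w = w} (_ , inj₂ (1w≈1 , _)) _ = trans (sym (*-identityˡ w)) 1w≈1

  module CleanGraphOn {p} (P : Carrier → Set p) where
    private
      G : Graph (c ⊔ ℓ ⊔ p) ℓ ℓ
      G = cleanGraphOn R P
      open Setoid (vertexSetoid R P) using () renaming (Carrier to Vertex; _≈_ to _≈ᵥ_)

    idem : Vertex → Carrier
    idem = proj₁ ∘ proj₁

    cleanAdj-sym : Symmetric (Graph.Adj G)
    cleanAdj-sym (x≉y , orth⊎inv) = (λ (e≈ , u≈) → x≉y (sym e≈ , sym u≈)) , Sum.map swap swap orth⊎inv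

    cleanAdj-resp : Graph.Adj G Respects₂ _≈ᵥ_
    cleanAdj-resp = (λ {x} {y} {z} → respʳ {x} {y} {z}) , λ {y} {x} {z} x≈z xy →
      cleanAdj-sym {y} {z} (respʳ {y} {x} {z} x≈z (cleanAdj-sym {x} {y} xy))
      where
        respʳ : Graph.Adj G Respectsʳ _≈ᵥ_
        respʳ (f≈f' , v≈v') (x≉y , orth⊎inv) =
          (λ (e≈ , u≈) → x≉y (trans e≈ (sym f≈f') , trans u≈ (sym v≈v'))) ,
          Sum.map (Prod.map (trans (*-congˡ (sym f≈f'))) (trans (*-congʳ (sym f≈f'))))
                  (Prod.map (trans (*-congˡ (sym v≈v'))) (trans (*-congʳ (sym v≈v'))))
                  orth⊎inv

    cleanAdj-irrefl : Irreflexive _≈ᵥ_ (Graph.Adj G)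
    cleanAdj-irrefl x≈y (x≉y , _) = x≉y x≈y

    zero-Dominating : ∀ x → idem x ≈ 0# → Dominating G x
    zero-Dominating ((e , _) , _) e≈0 ((f , _) , _) x≉y =
      x≉y , inj₁ (trans (*-congʳ e≈0) (zeroˡ f) , trans (*-congˡ e≈0) (zeroʳ f))

    AllUnitsTrivial⇒Complete : AllUnitsTrivial → Complete G
    AllUnitsTrivial⇒Complete trivialUnits ((_ , u) , (_ , u-unit)) ((_ , v) , (_ , v-unit)) x≉y =
      x≉y , inj₂ (1*1≈1 u-unit v-unit , 1*1≈1 v-unit u-unit)
      where
        1*1≈1 : ∀ {u v} → IsUnit R u → IsUnit R v → u * v ≈ 1#
        1*1≈1 {u} {v} u-unit v-unit = trans (*-cong (trivialUnits u u-unit) (trivialUnits v v-unit)) (*-identityˡ 1#)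

    nonzero-¬Dominating : HasNontrivialUnit → ∀ x → ¬ idem x ≈ 0# → ¬ Dominating G x
    nonzero-¬Dominating (a , a-unit , a≉1) ((e , u) , ((e-idem , Pe) , u-unit)) e≉0 dom with u ≟ 1#
    ... | yes u≈1 = a≉1 (begin
      a       ≈⟨ *-identityˡ a ⟨
      1# * a  ≈⟨ *-congʳ u≈1 ⟨
      u * a   ≈⟨ adj-same-idempotent⇒*≈1 e-idem e≉0 (dom y (λ (_ , u≈a) → a≉1 (trans (sym u≈a) u≈1))) ⟩
      1#      ∎)
      where
        y : Vertex
        y = (e , a) , ((e-idem , Pe) , a-unit)
    ... | no u≉1 = u≉1 (begin
      u       ≈⟨ *-identityʳ u ⟨
      u * 1#  ≈⟨ adj-same-idempotent⇒*≈1 e-idem e≉0 (dom y (λ (_ , u≈1) → u≉1 u≈1)) ⟩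
      1#      ∎)
      where
        y : Vertex
        y = (e , 1#) , ((e-idem , Pe) , 1-isUnit)

  open CleanGraphOn (λ _ → Trivial R) public
  module Cl₂-graph = CleanGraphOn (λ e → ¬ e ≈ 0#)

  Complete⇒AllUnitsTrivial : Complete (Cl R) → AllUnitsTrivial
  Complete⇒AllUnitsTrivial complete u u-unit with u ≟ 1#
  ... | yes u≈1 = u≈1
  ... | no u≉1 = ⊥-elim (u≉1 (begin
    u       ≈⟨ *-identityˡ u ⟨
    1# * u  ≈⟨ adj-same-idempotent⇒*≈1 1-idempotent 1≉0 (complete x y (λ (_ , 1≈u) → u≉1 (sym 1≈u))) ⟩
    1#      ∎))
    where
      1≉0 : ¬ 1# ≈ 0#
      1≉0 1≈0 = u≉1 (trivial⇒AllUnitsTrivial 1≈0 u u-unit)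
      x y : Setoid.Carrier V
      x = (1# , 1#) , ((1-idempotent , _) , 1-isUnit)
      y = (1# , u) , ((1-idempotent , _) , u-unit)

  V₂↔NonzeroIdempotents×Units : Inverse V₂ (NonzeroIdempotents ×ₛ Units)
  V₂↔NonzeroIdempotents×Units = record
    { to = λ ((e , u) , (e-nonzeroIdem , u-unit)) → (e , e-nonzeroIdem) , (u , u-unit)
    ; from = λ ((e , e-nonzeroIdem) , (u , u-unit)) → (e , u) , (e-nonzeroIdem , u-unit)
    ; to-cong = id ; from-cong = id ; inverse = id , id }

  Card-V₂ : Card V₂ (#nonzeroIdempotents ℕ.* #units)
  Card-V₂ = Compose.inverse V₂↔NonzeroIdempotents×Units (Card-× Card-NonzeroIdempotents Card-Units)

  private
    module V = Setoid V
    module U⊎V₂ = Setoid (Units ⊎ₛ V₂)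

    classify : (x : V.Carrier) → Dec (idem x ≈ 0#) → U⊎V₂.Carrier
    classify ((_ , u) , (_ , u-unit)) (yes _) = inj₁ (u , u-unit)
    classify ((e , u) , ((e-idem , _) , u-unit)) (no e≉0) = inj₂ ((e , u) , ((e-idem , e≉0) , u-unit))

    unclassify : U⊎V₂.Carrier → V.Carrier
    unclassify (inj₁ (u , u-unit)) = (0# , u) , ((0-idempotent , _) , u-unit)
    unclassify (inj₂ ((e , u) , ((e-idem , _) , u-unit))) = (e , u) , ((e-idem , _) , u-unit)

    classify-cong : ∀ {x y} x? y? → x V.≈ y → classify x x? U⊎V₂.≈ classify y y?
    classify-cong (yes _) (yes _) (_ , u≈v) = Pointwise⊎.inj₁ u≈v
    classify-cong (no _) (no _) x≈y = Pointwise⊎.inj₂ x≈y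
    classify-cong (yes e≈0) (no f≉0) (e≈f , _) = ⊥-elim (f≉0 (trans (sym e≈f) e≈0))
    classify-cong (no e≉0) (yes f≈0) (e≈f , _) = ⊥-elim (e≉0 (trans e≈f f≈0))

    classify-unclassify : ∀ {z x} x? → x V.≈ unclassify z → classify x x? U⊎V₂.≈ z
    classify-unclassify {inj₁ _} (yes _) (_ , u≈v) = Pointwise⊎.inj₁ u≈v
    classify-unclassify {inj₁ _} (no e≉0) (e≈0 , _) = ⊥-elim (e≉0 e≈0)
    classify-unclassify {inj₂ (_ , ((_ , f≉0) , _))} (yes e≈0) (e≈f , _) = ⊥-elim (f≉0 (trans (sym e≈f) e≈0))
    classify-unclassify {inj₂ _} (no _) x≈z = Pointwise⊎.inj₂ x≈z

    unclassify-classify : ∀ {x z} x? → z U⊎V₂.≈ classify x x? → unclassify z V.≈ x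
    unclassify-classify (yes e≈0) (Pointwise⊎.inj₁ v≈u) = sym e≈0 , v≈u
    unclassify-classify (no _) (Pointwise⊎.inj₂ z≈x) = z≈x

  split : Inverse V (Units ⊎ₛ V₂)
  split = record
    { to = λ x → classify x (idem x ≟ 0#)
    ; from = unclassify
    ; to-cong = λ {x} {y} → classify-cong (idem x ≟ 0#) (idem y ≟ 0#)
    ; from-cong = λ { (Pointwise⊎.inj₁ u≈v) → refl , u≈v ; (Pointwise⊎.inj₂ x≈y) → x≈y }
    ; inverse = (λ {_} {x} → classify-unclassify (idem x ≟ 0#)) , (λ {x} → unclassify-classify (idem x ≟ 0#)) }

  Card-V : Card V (#units ℕ.+ #nonzeroIdempotents ℕ.* #units)
  Card-V = Compose.inverse split (Card-⊎ Card-Units Card-V₂)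

  K-Units∨Cl₂≅Cl : K Units ∨ Cl₂ R ≅ Cl R
  K-Units∨Cl₂≅Cl = record
    { bij = Symmetry.inverse split
    ; adj-to = λ
        { (inj₁ u) (inj₁ v) u≉v →
            zero-Dominating (unclassify (inj₁ u)) refl (unclassify (inj₁ v)) (λ (_ , u≈v) → u≉v u≈v)
        ; (inj₁ u) (inj₂ y@(_ , ((_ , f≉0) , _))) _ →
            zero-Dominating (unclassify (inj₁ u)) refl (unclassify (inj₂ y)) (λ (0≈f , _) → f≉0 (sym 0≈f))
        ; (inj₂ x@(_ , ((_ , e≉0) , _))) (inj₁ v) _ → cleanAdj-sym {unclassify (inj₁ v)} {unclassify (inj₂ x)}
            (zero-Dominating (unclassify (inj₁ v)) refl (unclassify (inj₂ x)) (λ (0≈e , _) → e≉0 (sym 0≈e)))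
        ; (inj₂ _) (inj₂ _) xy → xy }
    ; adj-from = λ
        { (inj₁ _) (inj₁ _) (x≉y , _) u≈v → x≉y (refl , u≈v)
        ; (inj₁ _) (inj₂ _) _ → tt
        ; (inj₂ _) (inj₁ _) _ → tt
        ; (inj₂ _) (inj₂ _) xy → xy } }

  AllUnitsTrivial⇒#units≡1 : AllUnitsTrivial → #units ≡ 1
  AllUnitsTrivial⇒#units≡1 trivialUnits = Card-unique Card-Units Card-Units-1
    where
      Card-Units-1 : Card Units 1
      Card-Units-1 = record
        { to = λ _ → Fin.zero ; from = λ _ → 1# , 1-isUnit
        ; to-cong = λ _ → ≡.refl ; from-cong = λ _ → refl
        ; inverse = (λ { {Fin.zero} _ → ≡.refl }) , λ { {u , u-unit} _ → sym (trivialUnits u u-unit) } }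

  one₂ : ¬ 1# ≈ 0# → Setoid.Carrier V₂
  one₂ 1≉0 = (1# , 1#) , ((1-idempotent , 1≉0) , 1-isUnit)

  V₂-nonempty⇒nontrivial : Setoid.Carrier V₂ → ¬ 1# ≈ 0#
  V₂-nonempty⇒nontrivial ((e , _) , ((_ , e≉0) , _)) 1≈0 = e≉0 (trivial⇒≈0 1≈0 e)

  forget₂ : Setoid.Carrier V₂ → Setoid.Carrier V
  forget₂ ((e , u) , ((e-idem , _) , u-unit)) = (e , u) , ((e-idem , _) , u-unit)

  forget₂-nonzero : ∀ x → ¬ idem (forget₂ x) ≈ 0#
  forget₂-nonzero ((_ , _) , ((_ , e≉0) , _)) = e≉0

  restrict₂ : (x : Setoid.Carrier V) → ¬ idem x ≈ 0# → Setoid.Carrier V₂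
  restrict₂ ((e , u) , ((e-idem , _) , u-unit)) e≉0 = (e , u) , ((e-idem , e≉0) , u-unit)

  ≅Cl-¬Dominating⇒nonzero : ∀ {a ℓ' r} {G : Graph a ℓ' r} (Φ : G ≅ Cl R) x →
                            ¬ Dominating G x → ¬ idem (Inverse.to (_≅_.bij Φ) x) ≈ 0#
  ≅Cl-¬Dominating⇒nonzero Φ x ¬dominating e≈0 =
    ¬dominating (≅-reflects-Dominating Φ (zero-Dominating (Inverse.to (_≅_.bij Φ) x) e≈0))

module Comparison {c ℓ c' ℓ'} (R : Ring c ℓ) (finR : FiniteRing R) (S : Ring c' ℓ') (finS : FiniteRing S) where
  private
    module R = CleanGraph R finR
    module S = CleanGraph S finS
  open _≅_

  Cl≅⇒AllUnitsTrivial⇔ : Cl R ≅ Cl S → R.AllUnitsTrivial ⇔ S.AllUnitsTrivial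
  Cl≅⇒AllUnitsTrivial⇔ Φ = mk⇔
    (λ trivialR → S.Complete⇒AllUnitsTrivial
      (≅-reflects-Complete (≅-sym S.cleanAdj-resp Φ) (R.AllUnitsTrivial⇒Complete trivialR)))
    (λ trivialS → R.Complete⇒AllUnitsTrivial (≅-reflects-Complete Φ (S.AllUnitsTrivial⇒Complete trivialS)))

  Cl≅⇒Cl₂≅-trivialUnits : R.AllUnitsTrivial → S.AllUnitsTrivial → Cl R ≅ Cl S → Cl₂ R ≅ Cl₂ S
  Cl≅⇒Cl₂≅-trivialUnits trivialR trivialS Φ =
    complete-≅ (λ {x} {y} → R.Cl₂-graph.cleanAdj-irrefl {x} {y})
               (λ {x} {y} → S.Cl₂-graph.cleanAdj-irrefl {x} {y})
      (R.Cl₂-graph.AllUnitsTrivial⇒Complete trivialR) (S.Cl₂-graph.AllUnitsTrivial⇒Complete trivialS)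
      (Card⇒Inverse R.Card-V₂ (≡.subst (Card S.V₂) (≡.sym #V₂≡) S.Card-V₂))
    where
      open ≡.≡-Reasoning
      #V₂≡ : R.#nonzeroIdempotents ℕ.* R.#units ≡ S.#nonzeroIdempotents ℕ.* S.#units
      #V₂≡ = ℕ.+-cancelˡ-≡ 1 _ _ (begin
        1 ℕ.+ R.#nonzeroIdempotents ℕ.* R.#units
          ≡⟨ cong (ℕ._+ R.#nonzeroIdempotents ℕ.* R.#units) (R.AllUnitsTrivial⇒#units≡1 trivialR) ⟨
        R.#units ℕ.+ R.#nonzeroIdempotents ℕ.* R.#units
          ≡⟨ Card-unique R.Card-V (Compose.inverse (bij Φ) S.Card-V) ⟩
        S.#units ℕ.+ S.#nonzeroIdempotents ℕ.* S.#units
          ≡⟨ cong (ℕ._+ S.#nonzeroIdempotents ℕ.* S.#units) (S.AllUnitsTrivial⇒#units≡1 trivialS) ⟩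
        1 ℕ.+ S.#nonzeroIdempotents ℕ.* S.#units ∎)

  Cl≅⇒Cl₂≅-nontrivialUnits : R.HasNontrivialUnit → S.HasNontrivialUnit → Cl R ≅ Cl S → Cl₂ R ≅ Cl₂ S
  Cl≅⇒Cl₂≅-nontrivialUnits nontrivialR nontrivialS Φ = record
    { bij = record
      { to = λ x → S.restrict₂ (Φ.to (R.forget₂ x)) (to-nonzero x)
      ; from = λ y → R.restrict₂ (Φ.from (S.forget₂ y)) (from-nonzero y)
      ; to-cong = λ {x} {y} → Φ.to-cong {R.forget₂ x} {R.forget₂ y}
      ; from-cong = λ {x} {y} → Φ.from-cong {S.forget₂ x} {S.forget₂ y}
      ; inverse = (λ {x} {y} → Φ.inverseˡ {S.forget₂ x} {R.forget₂ y})
                , (λ {x} {y} → Φ.inverseʳ {R.forget₂ x} {S.forget₂ y}) }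
    ; adj-to = λ x y → adj-to Φ (R.forget₂ x) (R.forget₂ y)
    ; adj-from = λ x y → adj-from Φ (R.forget₂ x) (R.forget₂ y) }
    where
      module Φ = Inverse (bij Φ)
      to-nonzero : ∀ x → ¬ S.idem (Φ.to (R.forget₂ x)) S.≈ S.0#
      to-nonzero x = S.≅Cl-¬Dominating⇒nonzero Φ (R.forget₂ x)
        (R.nonzero-¬Dominating nontrivialR (R.forget₂ x) (R.forget₂-nonzero x))
      from-nonzero : ∀ y → ¬ R.idem (Φ.from (S.forget₂ y)) R.≈ R.0#
      from-nonzero y = R.≅Cl-¬Dominating⇒nonzero (≅-sym S.cleanAdj-resp Φ) (S.forget₂ y)
        (S.nonzero-¬Dominating nontrivialS (S.forget₂ y) (S.forget₂-nonzero y))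

  -- The neighbours of (1 , 1) in Cl₂(R) are the (f , 1) with f ≠ 1. If φ (1 , 1) = (e , v), every
  -- (g , v⁻¹) with g ≠ e is a neighbour of φ (1 , 1), so sending g to the idempotent of
  -- φ⁻¹ (g , v⁻¹), and e to 1, is injective.
  module OneNeighbourhood (1≉0 : ¬ R.1# R.≈ R.0#) (φ : Cl₂ R ≅ Cl₂ S) where
    private
      module φ = Inverse (bij φ)
      module NzIˢ = Setoid S.NonzeroIdempotents
      module NzIᴿ = Setoid R.NonzeroIdempotents

    y₀ : Setoid.Carrier S.V₂
    y₀ = φ.to (R.one₂ 1≉0)

    e v v⁻¹ : S.Carrier
    e = proj₁ (proj₁ y₀)
    v = proj₂ (proj₁ y₀)
    v⁻¹ = proj₁ (proj₂ (proj₂ y₀))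

    v⁻¹-isUnit : IsUnit S v⁻¹
    v⁻¹-isUnit = v , swap (proj₂ (proj₂ (proj₂ y₀)))

    partner : NzIˢ.Carrier → Setoid.Carrier S.V₂
    partner (g , g-nonzeroIdem) = (g , v⁻¹) , (g-nonzeroIdem , v⁻¹-isUnit)

    preimage : NzIˢ.Carrier → Setoid.Carrier R.V₂
    preimage g = φ.from (partner g)

    preimage-adj : ∀ g → ¬ proj₁ g S.≈ e → cleanAdj R (R.1# , R.1#) (proj₁ (preimage g))
    preimage-adj g g≉e =
      adj-from φ (R.one₂ 1≉0) (preimage g)
        (proj₁ S.Cl₂-graph.cleanAdj-resp {y₀} {partner g} {φ.to (preimage g)}
          (Setoid.sym S.V₂ {φ.to (preimage g)} {partner g} (φ.strictlyInverseˡ (partner g)))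
          ((λ (e≈g , _) → g≉e (S.sym e≈g)) , inj₂ (proj₂ (proj₂ (proj₂ y₀)))))

    preimage-unit≈1 : ∀ g → ¬ proj₁ g S.≈ e → proj₂ (proj₁ (preimage g)) R.≈ R.1#
    preimage-unit≈1 g g≉e = R.adj-one⇒unit≈1 (preimage-adj g g≉e) (proj₂ (proj₁ (proj₂ (preimage g))))

    private
      collapse : (g : NzIˢ.Carrier) → Dec (proj₁ g S.≈ e) → NzIᴿ.Carrier
      collapse _ (yes _) = R.1# , (R.1-idempotent , 1≉0)
      collapse g (no _) = proj₁ (proj₁ (preimage g)) , proj₁ (proj₂ (preimage g))

      collapse-cong : ∀ {g h} g? h? → g NzIˢ.≈ h → collapse g g? NzIᴿ.≈ collapse h h?
      collapse-cong (yes _) (yes _) _ = R.refl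
      collapse-cong (no _) (no _) g≈h = proj₁ (φ.from-cong (g≈h , S.refl))
      collapse-cong (yes g≈e) (no h≉e) g≈h = ⊥-elim (h≉e (S.trans (S.sym g≈h) g≈e))
      collapse-cong (no g≉e) (yes h≈e) g≈h = ⊥-elim (g≉e (S.trans g≈h h≈e))

      collapse-injective : ∀ {g h} g? h? → collapse g g? NzIᴿ.≈ collapse h h? → g NzIˢ.≈ h
      collapse-injective (yes g≈e) (yes h≈e) _ = S.trans g≈e (S.sym h≈e)
      collapse-injective {g} {h} (no g≉e) (no h≉e) eq =
        proj₁ (to-injective (Symmetry.inverse (bij φ))
          (eq , R.trans (preimage-unit≈1 g g≉e) (R.sym (preimage-unit≈1 h h≉e))))
      collapse-injective {h = h} (yes _) (no h≉e) 1≈f =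
        ⊥-elim (proj₁ (preimage-adj h h≉e) (1≈f , R.sym (preimage-unit≈1 h h≉e)))
      collapse-injective {g} (no g≉e) (yes _) f≈1 =
        ⊥-elim (proj₁ (preimage-adj g g≉e) (R.sym f≈1 , R.sym (preimage-unit≈1 g g≉e)))

    collapse-injection : Injection S.NonzeroIdempotents R.NonzeroIdempotents
    collapse-injection = record
      { to = λ g → collapse g (proj₁ g S.≟ e)
      ; cong = λ {g} {h} → collapse-cong (proj₁ g S.≟ e) (proj₁ h S.≟ e)
      ; injective = λ {g} {h} → collapse-injective (proj₁ g S.≟ e) (proj₁ h S.≟ e) }

  Cl₂≅⇒#nonzeroIdempotents≥ : ¬ R.1# R.≈ R.0# → Cl₂ R ≅ Cl₂ S →
                              S.#nonzeroIdempotents ≤ R.#nonzeroIdempotents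
  Cl₂≅⇒#nonzeroIdempotents≥ 1≉0 φ =
    Card-≤ S.Card-NonzeroIdempotents R.Card-NonzeroIdempotents (OneNeighbourhood.collapse-injection 1≉0 φ)

module _ {c ℓ c' ℓ'} (R : Ring c ℓ) (finR : FiniteRing R) (S : Ring c' ℓ') (finS : FiniteRing S) where
  private
    module R = CleanGraph R finR
    module S = CleanGraph S finS
    module S↔R = Comparison S finS R finR
  open Comparison R finR S finS
  open _≅_

  Cl₂≅⇒#nonzeroIdempotents≡ : ¬ R.1# R.≈ R.0# → Cl₂ R ≅ Cl₂ S →
                              R.#nonzeroIdempotents ≡ S.#nonzeroIdempotents
  Cl₂≅⇒#nonzeroIdempotents≡ 1≉0 φ = ℕ.≤-antisym
    (S↔R.Cl₂≅⇒#nonzeroIdempotents≥ (S.V₂-nonempty⇒nontrivial (Inverse.to (bij φ) (R.one₂ 1≉0)))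
      (≅-sym S.Cl₂-graph.cleanAdj-resp φ))
    (Cl₂≅⇒#nonzeroIdempotents≥ 1≉0 φ)

  Cl₂≅⇒#units≡ : Cl₂ R ≅ Cl₂ S → R.#units ≡ S.#units
  Cl₂≅⇒#units≡ φ with R.1# R.≟ R.0# | S.1# S.≟ S.0#
  ... | yes 1≈0 | yes 1≈0′ = ≡.trans (R.AllUnitsTrivial⇒#units≡1 (R.trivial⇒AllUnitsTrivial 1≈0))
                                   (≡.sym (S.AllUnitsTrivial⇒#units≡1 (S.trivial⇒AllUnitsTrivial 1≈0′)))
  ... | yes 1≈0 | no 1≉0′ = ⊥-elim (R.V₂-nonempty⇒nontrivial (Inverse.from (bij φ) (S.one₂ 1≉0′)) 1≈0)
  ... | no 1≉0 | _ = ℕ.*-cancelˡ-≡ R.#units S.#units R.#nonzeroIdempotents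
                       (≡.trans #V₂≡ (cong (ℕ._* S.#units) (≡.sym (Cl₂≅⇒#nonzeroIdempotents≡ 1≉0 φ))))
    where
      instance
        #nonzeroIdempotents≢0 : ℕ.NonZero R.#nonzeroIdempotents
        #nonzeroIdempotents≢0 = Card-nonZero R.Card-NonzeroIdempotents (R.1# , (R.1-idempotent , 1≉0))
      #V₂≡ : R.#nonzeroIdempotents ℕ.* R.#units ≡ S.#nonzeroIdempotents ℕ.* S.#units
      #V₂≡ = Card-unique R.Card-V₂ (Compose.inverse (bij φ) S.Card-V₂)

  Cl₂≅⇒Cl≅ : Cl₂ R ≅ Cl₂ S → Cl R ≅ Cl S
  Cl₂≅⇒Cl≅ φ =
    ≅-trans (≅-sym R.cleanAdj-resp R.K-Units∨Cl₂≅Cl) (≅-trans (K∨-cong units↔ φ) S.K-Units∨Cl₂≅Cl)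
    where
      units↔ : Inverse R.Units S.Units
      units↔ = Card⇒Inverse R.Card-Units (≡.subst (Card S.Units) (≡.sym (Cl₂≅⇒#units≡ φ)) S.Card-Units)

  Cl≅⇒Cl₂≅ : Cl R ≅ Cl S → Cl₂ R ≅ Cl₂ S
  Cl≅⇒Cl₂≅ Φ with R.hasNontrivialUnit? | S.hasNontrivialUnit?
  ... | yes nontrivialR | yes nontrivialS = Cl≅⇒Cl₂≅-nontrivialUnits nontrivialR nontrivialS Φ
  ... | no ¬nontrivialR | _ =
    Cl≅⇒Cl₂≅-trivialUnits trivialR (Equivalence.to (Cl≅⇒AllUnitsTrivial⇔ Φ) trivialR) Φ
    where
      trivialR : R.AllUnitsTrivial
      trivialR = R.¬HasNontrivialUnit⇒AllUnitsTrivial ¬nontrivialR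
  ... | yes _ | no ¬nontrivialS =
    Cl≅⇒Cl₂≅-trivialUnits (Equivalence.from (Cl≅⇒AllUnitsTrivial⇔ Φ) trivialS) trivialS Φ
    where
      trivialS : S.AllUnitsTrivial
      trivialS = S.¬HasNontrivialUnit⇒AllUnitsTrivial ¬nontrivialS

mainTheorem2 : ∀ {c ℓ c' ℓ'} (R : Ring c ℓ) (S : Ring c' ℓ') → FiniteRing R → FiniteRing S → (Cl R ≅ Cl S) ⇔ (Cl₂ R ≅ Cl₂ S)
mainTheorem2 R S finR finS = mk⇔ (Cl≅⇒Cl₂≅ R finR S finS) (Cl₂≅⇒Cl≅ R finR S finS)
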